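{- Let $X$ be a finite totally ordered alphabet and $U\subseteq X\times X$ a relation. If there exists $x\in X$ such that $U\subseteq (X\setminus\{x\})\times(X\setminus\{x\})$ and $U\neq\emptyset$, then it is not the case that $\mathrm{inv}'_U$ and $\mathrm{maj}'_U$ are equidistributed on every rearrangement class of words over $X$.
   Context: Words over $X$: finite sequences $w=x_1\cdots x_m$; a rearrangement class is the set of all words with a prescribed number of occurrences of each letter. $\mathrm{maj}'_U w=\sum_{i=1}^{m-1}i\,\chi((x_i,x_{i+1})\in U)$, $\mathrm{inv}'_U w=\sum_{1\le i<j\le m}\chi((x_i,x_j)\in U)$, $\chi$ the truth indicator. Equidistributed on a class means: for every integer $k$, the same number of words in the class have statistic value $k$ under each statistic. -}

module Defs where

open import Data.Bool using (Bool; true; false; if_then_else_)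
open import Data.Nat using (ℕ; zero; suc; _+_; _*_; _≟_)
open import Data.Fin using (Fin)
import Data.Fin.Properties as FinP
open import Data.List using (List; []; _∷_; filter; length; map; concatMap; allFin; foldr)
open import Relation.Nullary.Decidable using (does)

-- Alphabet X = Fin n, totally ordered by the usual order on Fin n.
-- A relation U ⊆ X × X is given by its (Boolean) characteristic function.
Rel : ℕ → Set
Rel n = Fin n → Fin n → Bool

Word : ℕ → Set
Word n = List (Fin n)

χ : Bool → ℕ
χ true  = 1
χ false = 0

invU : ∀ {n} → Rel n → Word n → ℕ
invU U []      = 0
invU U (x ∷ w) = foldr (λ y acc → χ (U x y) + acc) 0 w + invU U w

majFrom : ∀ {n} → Rel n → ℕ → Word n → ℕ
majFrom U i []           = 0
majFrom U i (x ∷ [])     = 0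
majFrom U i (x ∷ y ∷ w)  = i * χ (U x y) + majFrom U (suc i) (y ∷ w)

majU : ∀ {n} → Rel n → Word n → ℕ
majU U w = majFrom U 1 w

occ : ∀ {n} → Fin n → Word n → ℕ
occ a []      = 0
occ a (x ∷ w) = (if does (a FinP.≟ x) then 1 else 0) + occ a w

wordsOfLength : ∀ n → ℕ → List (Word n)
wordsOfLength n zero    = [] ∷ []
wordsOfLength n (suc m) = concatMap (λ x → map (x ∷_) (wordsOfLength n m)) (allFin n)

-- the rearrangement class with multiplicities c : X → ℕ (a list of words,
-- each appearing exactly once)
rearrClass : ∀ {n} → (Fin n → ℕ) → List (Word n)
rearrClass {n} c =
  filter (λ w → FinP.all? (λ a → occ a w ≟ c a))
         (wordsOfLength n (foldr _+_ 0 (map c (allFin n))))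

countStat : ∀ {n} → (Word n → ℕ) → List (Word n) → ℕ → ℕ
countStat st ws k = length (filter (λ w → st w ≟ k) ws)

Equidistributed : ∀ {n} → (Word n → ℕ) → (Word n → ℕ) → List (Word n) → Set
Equidistributed s t ws = ∀ (k : ℕ) → countStat s ws k ≡ countStat t ws k
  where open import Relation.Binary.PropositionalEquality using (_≡_)

{-# OPTIONS --safe #-}
-- Pick U a b and look at the class of the word x a b. Since x is unrelated to
-- every letter, erasing it leaves inv' unchanged, so every word of the class
-- has the inv' of a two-letter word, which is at most 1; but
-- maj'(x a b) = 1·χ(U x a) + 2·χ(U a b) = 2.
module Submission where

open import Defs
open import Data.Bool using (true; false; if_then_else_)
open import Data.Bool.Properties using (¬-not)
open import Data.Nat using (ℕ; zero; suc; _+_; _≤_; _<_; z≤n; s≤s; _≟_)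
open import Data.Nat.Properties using (+-0-commutativeMonoid; +-suc; suc-injective; <-irrefl; <⇒≢)
open import Data.Fin using (Fin)
import Data.Fin as F
import Data.Fin.Properties as FinP
open import Data.List using (List; []; _∷_; filter; length; map; allFin; foldr; tabulate)
open import Data.List.Properties using (map-tabulate; filter-none; filter-some)
open import Data.List.Relation.Unary.Any as Any using (here)
import Data.List.Relation.Unary.All as All
open import Data.List.Membership.Propositional using (_∈_)
open import Data.List.Membership.Propositional.Properties
  using (∈-filter⁺; ∈-filter⁻; ∈-concatMap⁺; ∈-map⁺; ∈-allFin)
open import Data.Product using (_×_; ∃-syntax; _,_; proj₁; proj₂)
open import Relation.Binary.PropositionalEquality
  using (_≡_; _≢_; _≗_; refl; sym; trans; cong; cong₂; subst; module ≡-Reasoning)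
open import Relation.Nullary using (¬_; yes; no; does; ¬?)
open import Relation.Nullary.Decidable using (dec-true; dec-false)
open import Function using (id; _∘_)
open import Algebra.Properties.CommutativeMonoid.Sum +-0-commutativeMonoid
  using (sum; ∑-distrib-+; sum-replicate-zero; sum-cong-≗)

open ≡-Reasoning

private
  variable
    n : ℕ

sum-tabulate : (f : Fin n → ℕ) → foldr _+_ 0 (tabulate f) ≡ sum f
sum-tabulate {zero}  f = refl
sum-tabulate {suc n} f = cong (f F.zero +_) (sum-tabulate (f ∘ F.suc))

sum-allFin : (f : Fin n → ℕ) → foldr _+_ 0 (map f (allFin n)) ≡ sum f
sum-allFin f = trans (cong (foldr _+_ 0) (map-tabulate id f)) (sum-tabulate f)

δ : Fin n → Fin n → ℕ
δ a z = if does (a FinP.≟ z) then 1 else 0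

sum-δ : (z : Fin n) → sum (λ a → δ a z) ≡ 1
sum-δ {suc n} F.zero    = cong suc (sum-replicate-zero n)
sum-δ {suc n} (F.suc z) = sum-δ z

content : Word n → Fin n → ℕ
content w a = occ a w

sum-content : (w : Word n) → sum (content w) ≡ length w
sum-content {n} []      = sum-replicate-zero n
sum-content     (z ∷ w) = begin
  sum (λ a → δ a z + occ a w)         ≡⟨ ∑-distrib-+ (λ a → δ a z) (content w) ⟩
  sum (λ a → δ a z) + sum (content w) ≡⟨ cong₂ _+_ (sum-δ z) (sum-content w) ⟩
  suc (length w)                      ∎

∈-wordsOfLength : (w : Word n) → w ∈ wordsOfLength n (length w)
∈-wordsOfLength []      = here refl
∈-wordsOfLength {n} (z ∷ w) =
  ∈-concatMap⁺ (λ x → map (x ∷_) (wordsOfLength n (length w)))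
    (Any.map (λ { refl → ∈-map⁺ (z ∷_) (∈-wordsOfLength w) }) (∈-allFin z))

∈-rearrClass-content : (w : Word n) → w ∈ rearrClass (content w)
∈-rearrClass-content {n} w =
  ∈-filter⁺ _ (subst (λ m → w ∈ wordsOfLength n m) (sym size≡) (∈-wordsOfLength w)) (λ _ → refl)
  where
  size≡ : foldr _+_ 0 (map (content w) (allFin n)) ≡ length w
  size≡ = trans (sum-allFin (content w)) (sum-content w)

∈-rearrClass⁻ : {c : Fin n → ℕ} {v : Word n} → v ∈ rearrClass c → content v ≗ c
∈-rearrClass⁻ {n} {c} v∈ = ∈-filter⁻ (λ w → FinP.all? (λ a → occ a w ≟ c a))
  {xs = wordsOfLength n (foldr _+_ 0 (map c (allFin n)))} v∈ .proj₂

length-rearrClass : (w : Word n) {v : Word n} → v ∈ rearrClass (content w) → length v ≡ length w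
length-rearrClass w {v} v∈ = begin
  length v          ≡⟨ sum-content v ⟨
  sum (content v)   ≡⟨ sum-cong-≗ (∈-rearrClass⁻ v∈) ⟩
  sum (content w)   ≡⟨ sum-content w ⟩
  length w          ∎

erase : Fin n → Word n → Word n
erase x = filter (λ y → ¬? (x FinP.≟ y))

length-erase : (x : Fin n) (w : Word n) → occ x w + length (erase x w) ≡ length w
length-erase x []      = refl
length-erase x (y ∷ w) with x FinP.≟ y
... | yes _ = cong suc (length-erase x w)
... | no  _ = trans (+-suc (occ x w) _) (cong suc (length-erase x w))

row : Rel n → Fin n → Word n → ℕ
row U z = foldr (λ y acc → χ (U z y) + acc) 0

row-unrelated : (U : Rel n) (x : Fin n) → (∀ y → U x y ≡ false) → (w : Word n) → row U x w ≡ 0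
row-unrelated U x Ux· []      = refl
row-unrelated U x Ux· (y ∷ w) rewrite Ux· y = row-unrelated U x Ux· w

row-erase : (U : Rel n) (z x : Fin n) → U z x ≡ false → (w : Word n) → row U z w ≡ row U z (erase x w)
row-erase U z x Uzx []      = refl
row-erase U z x Uzx (y ∷ w) with x FinP.≟ y
... | yes refl rewrite Uzx = row-erase U z x Uzx w
... | no  _    = cong (χ (U z y) +_) (row-erase U z x Uzx w)

invU-erase : (U : Rel n) (x : Fin n) → (∀ y → U x y ≡ false) → (∀ y → U y x ≡ false) →
             (w : Word n) → invU U w ≡ invU U (erase x w)
invU-erase U x Ux· U·x []      = refl
invU-erase U x Ux· U·x (y ∷ w) with x FinP.≟ y
... | yes refl = trans (cong (_+ invU U w) (row-unrelated U x Ux· w)) (invU-erase U x Ux· U·x w)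
... | no  _    = cong₂ _+_ (row-erase U y x (U·x y) w) (invU-erase U x Ux· U·x w)

invU-length2 : (U : Rel n) (v : Word n) → length v ≡ 2 → invU U v ≤ 1
invU-length2 U (p ∷ q ∷ []) refl with U p q
... | true  = s≤s z≤n
... | false = z≤n

missed-value⇒¬equidistributed : {s t : Word n → ℕ} {ws : List (Word n)} {w : Word n} {k : ℕ} →
                                w ∈ ws → t w ≡ k → (∀ {v} → v ∈ ws → s v ≢ k) → ¬ Equidistributed s t ws
missed-value⇒¬equidistributed {s = s} {t} {ws} {k = k} w∈ tw≡k s≢k equi =
  <-irrefl refl (subst (0 <_) (trans (sym (equi k)) s-misses-k) t-hits-k)
  where
  t-hits-k : 0 < countStat t ws k
  t-hits-k = filter-some (λ v → t v ≟ k) (Any.map (λ { refl → tw≡k }) w∈)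
  s-misses-k : countStat s ws k ≡ 0
  s-misses-k = cong length (filter-none (λ v → s v ≟ k) (All.tabulate s≢k))

lemma6p1 : (n : ℕ) (U : Rel n) →
    (∃[ x ] (∀ (a b : Fin n) → U a b ≡ true → (a ≢ x) × (b ≢ x))) →
    (∃[ a ] ∃[ b ] U a b ≡ true) →
    ¬ (∀ (c : Fin n → ℕ) → Equidistributed (invU U) (majU U) (rearrClass c))
lemma6p1 n U (x , isolated) (a , b , Uab) =
  λ equi → missed-value⇒¬equidistributed (∈-rearrClass-content xab) majU-xab invU≢2 (equi (content xab))
  where
  xab : Word n
  xab = x ∷ a ∷ b ∷ []

  Ux· : ∀ y → U x y ≡ false
  Ux· y = ¬-not (λ Uxy → proj₁ (isolated x y Uxy) refl)

  U·x : ∀ y → U y x ≡ false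
  U·x y = ¬-not (λ Uyx → proj₂ (isolated y x Uyx) refl)

  majU-xab : majU U xab ≡ 2
  majU-xab rewrite Ux· a | Uab = refl

  occ-x : occ x xab ≡ 1
  occ-x rewrite dec-true (x FinP.≟ x) refl
              | dec-false (x FinP.≟ a) (proj₁ (isolated a b Uab) ∘ sym)
              | dec-false (x FinP.≟ b) (proj₂ (isolated a b Uab) ∘ sym) = refl

  invU≢2 : ∀ {v} → v ∈ rearrClass (content xab) → invU U v ≢ 2
  invU≢2 {v} v∈ = <⇒≢ (s≤s (subst (_≤ 1) (sym (invU-erase U x Ux· U·x v))
                                        (invU-length2 U (erase x v) length-erased)))
    where
    length-erased : length (erase x v) ≡ 2
    length-erased = suc-injective (begin
      1 + length (erase x v)         ≡⟨ cong (_+ length (erase x v)) (trans (∈-rearrClass⁻ v∈ x) occ-x) ⟨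
      occ x v + length (erase x v)   ≡⟨ length-erase x v ⟩
      length v                       ≡⟨ length-rearrClass xab v∈ ⟩
      3                              ∎)
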